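{- For every $n\geq 1$, the path $P_n$ on $n$ vertices satisfies $\gamma_{1/2}(P_n)=\lceil n/6\rceil$.
   Context: All graphs are finite and simple. For a graph $G=(V,E)$ and $v\in V$, $N[v]=\{v\}\cup\{u : uv\in E\}$, and for $S\subseteq V$, $N[S]=\bigcup_{u\in S}N[u]$. For $p\in[0,1]$, a set $S\subseteq V$ is a $p$-dominating set if $|N[S]|/|V|\geq p$; the $p$-domination number $\gamma_p(G)$ is the minimum cardinality of a $p$-dominating set of $G$. -}

module Defs where

open import Data.Nat using (ℕ; suc; _+_)
open import Data.Bool using (Bool; true; false; _∨_; _∧_; not)
open import Data.Fin using (Fin; toℕ)
open import Data.Fin.Subset using (Subset; ∣_∣; _∈_)
open import Data.Vec using (tabulate; lookup)
open import Data.Vec.Functional using () renaming (foldr to ffoldr)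
open import Data.Integer using (ℤ; +_)
open import Data.Rational using (ℚ; _≤_; _*_; _/_)
open import Data.Product using (Σ; _×_; _,_)
open import Relation.Binary.PropositionalEquality using (_≡_)
open import Relation.Nullary using (¬_; yes; no)
open import Data.Empty using (⊥-elim)
open import Data.Nat.Properties using (1+n≢n)
open import Relation.Binary.PropositionalEquality using (sym; refl)
import Data.Nat

record Graph (n : ℕ) : Set where
  field
    adj       : Fin n → Fin n → Bool
    adj-sym   : ∀ u v → adj u v ≡ adj v u
    adj-irrefl : ∀ v → adj v v ≡ false
open Graph public

inClosedNbhd : ∀ {n} → Graph n → Subset n → Fin n → Bool
inClosedNbhd {n} G S u =
  ffoldr (λ v b → (lookup S v ∧ ((isTrue (u Data.Fin.≟ v)) ∨ adj G v u)) ∨ b) false (λ v → v)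
  where
    open import Relation.Nullary.Decidable using (⌊_⌋)
    import Data.Fin
    isTrue = ⌊_⌋

closedNbhd : ∀ {n} → Graph n → Subset n → Subset n
closedNbhd G S = tabulate (inClosedNbhd G S)

-- S is p-dominating : |N[S]| / |V| ≥ p, written as p * |V| ≤ |N[S]| (avoids dividing by |V|)
IsPDominating : ∀ {n} → ℚ → Graph n → Subset n → Set
IsPDominating {n} p G S = p * ((+ n) / 1) ≤ ((+ ∣ closedNbhd G S ∣) / 1)

IsPDominationNumber : ∀ {n} → ℚ → Graph n → ℕ → Set
IsPDominationNumber {n} p G k =
  Σ (Subset n) (λ S → IsPDominating p G S × ∣ S ∣ ≡ k)
  × (∀ (S : Subset n) → IsPDominating p G S → k Data.Nat.≤ ∣ S ∣)
  where import Data.Nat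

pathAdj : ∀ {n} → Fin n → Fin n → Bool
pathAdj i j = isTrue (suc (toℕ i) ≟ toℕ j) ∨ isTrue (suc (toℕ j) ≟ toℕ i)
  where
    open import Data.Nat using (_≟_)
    open import Relation.Nullary.Decidable using (⌊_⌋)
    isTrue = ⌊_⌋

pathAdj-sym : ∀ {n} (i j : Fin n) → pathAdj i j ≡ pathAdj j i
pathAdj-sym i j = ∨-comm (isTrue (suc (toℕ i) ≟ toℕ j)) (isTrue (suc (toℕ j) ≟ toℕ i))
  where
    open import Data.Nat using (_≟_)
    open import Relation.Nullary.Decidable using (⌊_⌋)
    open import Data.Bool.Properties using (∨-comm)
    isTrue = ⌊_⌋

pathAdj-irrefl : ∀ {n} (i : Fin n) → pathAdj i i ≡ false
pathAdj-irrefl i with suc (toℕ i) Data.Nat.≟ toℕ i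
... | yes e = ⊥-elim (1+n≢n e)
... | no _ = refl

Path : (n : ℕ) → Graph n
Path n = record { adj = pathAdj ; adj-sym = pathAdj-sym ; adj-irrefl = pathAdj-irrefl }

-- A vertex of a path dominates at most three vertices, so a ½-dominating set S of P_n
-- satisfies n ≤ 2 ∣N[S]∣ ≤ 6 ∣S∣, i.e. ∣S∣ ≥ ⌈n/6⌉. Conversely the vertices 1, 7, 13, …
-- (moving the last one to n − 1 when n ≡ 1 mod 6) dominate the first half of every block
-- of six consecutive vertices, and there are ⌈n/6⌉ of them. On the rational side, ⌈n/6⌉ is
-- pinned down as the unique k with n ≤ 6k < n + 6, a property that survives reducing n/6.
module Submission where

open import Defs
open import Data.Nat using (ℕ; zero; suc; _+_; _*_; _≤_; _<_; _≥_; z≤n; s≤s; z<s; s<s; _≟_;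
  NonZero; ≢-nonZero; ≢-nonZero⁻¹)
open import Data.Nat.Properties
open import Data.Nat.DivMod using (_%_; m≡m%n+[m/n]*n; m%n<n; m/n*n≡m) renaming (_/_ to _÷_)
open import Data.Nat.GCD using (gcd; gcd[m,n]∣m; gcd[m,n]∣n; gcd[m,n]≢0; n/gcd[m,n]≢0)
open import Data.Nat.Coprimality using (Coprime; coprime-/gcd)
import Data.Nat.Coprimality as Coprime
open import Data.Integer using (+_; -_; -[1+_]; +≤+)
import Data.Integer as ℤ
import Data.Integer.Properties as ℤ
open import Data.Rational using (ceiling; mkℚ; mkℚ+; ½; _/_; toℚᵘ)
import Data.Rational as ℚ
open import Data.Rational.Properties
  using (normalize-coprime; toℚᵘ-homo-*; toℚᵘ-mono-≤; toℚᵘ-cancel-≤)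
open import Data.Rational.Unnormalised using (*≤*; _≃_)
import Data.Rational.Unnormalised as ℚᵘ
open import Data.Rational.Unnormalised.Properties using (≤-respˡ-≃; ≃-sym; drop-*≤*)
open import Data.Bool using (Bool; true; false; T; _∨_; _∧_)
open import Data.Bool.Properties using (T-∨; T-∧; ⇔→≡; T-≡)
open import Data.Fin using (Fin; toℕ) renaming (zero to fzero; suc to fsuc; _≟_ to _≟ᶠ_)
open import Data.Fin.Properties using (toℕ-injective)
open import Data.Fin.Subset using (Subset; ∣_∣; inside; outside)
open import Data.Vec using (Vec; []; _∷_; lookup; tabulate)
open import Data.Vec.Functional using () renaming (foldr to ffoldr)
open import Data.Product using (Σ; _×_; _,_; ∃-syntax)
open import Data.Sum using (_⊎_; inj₁; inj₂; map; map₁)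
open import Function using (_∘_; _⇔_; mk⇔; Equivalence)
open import Function.Construct.Composition using (_⇔-∘_)
open import Function.Construct.Symmetry using (⇔-sym)
open import Relation.Nullary.Decidable using (⌊_⌋; toWitness; fromWitness)
open import Relation.Binary.PropositionalEquality
open import Algebra.Properties.CommutativeSemigroup +-commutativeSemigroup using (interchange)

record IsCeilDiv (a d k : ℕ) : Set where
  constructor ceilDiv
  field
    ≤k*d : a ≤ k * d
    k*d< : k * d < a + d

IsCeilDiv-least : ∀ {a d k m} → IsCeilDiv a d k → a ≤ m * d → k ≤ m
IsCeilDiv-least {a} {d} {k} {m} (ceilDiv _ kd<a+d) a≤md = ≤-pred (*-cancelʳ-< d k (suc m) kd<[1+m]d)
  where
  open ≤-Reasoning
  kd<[1+m]d : k * d < suc m * d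
  kd<[1+m]d = begin-strict
    k * d     <⟨ kd<a+d ⟩
    a + d     ≤⟨ +-monoˡ-≤ d a≤md ⟩
    m * d + d ≡⟨ +-comm (m * d) d ⟩
    suc m * d ∎

IsCeilDiv-unique : ∀ {a d k l} → IsCeilDiv a d k → IsCeilDiv a d l → k ≡ l
IsCeilDiv-unique ck@(ceilDiv a≤kd _) cl@(ceilDiv a≤ld _) =
  ≤-antisym (IsCeilDiv-least ck a≤ld) (IsCeilDiv-least cl a≤kd)

IsCeilDiv-*ʳ : ∀ {a d k} g .{{_ : NonZero g}} → IsCeilDiv a d k → IsCeilDiv (a * g) (d * g) k
IsCeilDiv-*ʳ {a} {d} {k} g (ceilDiv a≤kd kd<a+d) = ceilDiv
  (subst (a * g ≤_) (*-assoc k d g) (*-monoˡ-≤ g a≤kd))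
  (subst₂ _<_ (*-assoc k d g) (*-distribʳ-+ g a d) (*-monoˡ-< g kd<a+d))

ceiling-mkℚ+ : ∀ a d .{{_ : NonZero d}} .(c : Coprime a d) →
               ∃[ k ] IsCeilDiv a d k × ceiling (mkℚ+ a d c) ≡ + k
ceiling-mkℚ+ zero d@(suc _) c = 0 , ceilDiv z≤n z<s , refl
-- ceiling p = - floor (- p), and the ℤ division of - a by d branches on a % d
ceiling-mkℚ+ a@(suc _) d@(suc _) c with a % d | m≡m%n+[m/n]*n a d | m%n<n a d
... | zero  | a≡qd   | _   =
  a ÷ d , ceilDiv (≤-reflexive a≡qd) (subst (_< a + d) a≡qd (m<m+n a z<s)) ,
  trans (cong -_ (ℤ.*-identityˡ (- + (a ÷ d)))) (ℤ.neg-involutive _)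
... | suc r | a≡r+qd | 1+r<d = suc (a ÷ d) , ceilDiv a≤ <a+d , cong -_ (ℤ.*-identityˡ -[1+ a ÷ d ])
  where
  qd<a : a ÷ d * d < a
  qd<a = subst (a ÷ d * d <_) (sym a≡r+qd) (m<n+m (a ÷ d * d) z<s)
  a≤ : a ≤ suc (a ÷ d) * d
  a≤ = subst (_≤ suc (a ÷ d) * d) (sym a≡r+qd) (+-monoˡ-≤ (a ÷ d * d) (<⇒≤ 1+r<d))
  <a+d : suc (a ÷ d) * d < a + d
  <a+d = subst (_< a + d) (+-comm (a ÷ d * d) d) (+-monoˡ-< d qd<a)

ceiling-/ : ∀ a d .{{_ : NonZero d}} {k} → IsCeilDiv a d k → ceiling (+ a / d) ≡ + k
ceiling-/ a d {k} a/d≈k = reduced (ceiling-mkℚ+ (a ÷ g) (d ÷ g) (coprime-/gcd a d))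
  where
  g : ℕ
  g = gcd a d
  instance
    g≢0 : NonZero g
    g≢0 = ≢-nonZero (gcd[m,n]≢0 a d (inj₂ (≢-nonZero⁻¹ d)))
    d/g≢0 : NonZero (d ÷ g)
    d/g≢0 = ≢-nonZero (n/gcd[m,n]≢0 a d)
  unscale : ∀ {l} → IsCeilDiv (a ÷ g) (d ÷ g) l → IsCeilDiv a d l
  unscale {l} = subst₂ (λ x y → IsCeilDiv x y l) (m/n*n≡m (gcd[m,n]∣m a d)) (m/n*n≡m (gcd[m,n]∣n a d))
              ∘ IsCeilDiv-*ʳ g
  reduced : ∃[ l ] IsCeilDiv (a ÷ g) (d ÷ g) l × ceiling (mkℚ+ (a ÷ g) (d ÷ g) (coprime-/gcd a d)) ≡ + l
          → ceiling (+ a / d) ≡ + k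
  reduced (l , a'/d'≈l , ceiling≡l) =
    trans ceiling≡l (cong +_ (IsCeilDiv-unique (unscale a'/d'≈l) a/d≈k))

coprime-1 : ∀ n → Coprime n 1
coprime-1 n = Coprime.sym (Coprime.1-coprimeTo n)

n/1≡mkℚ : ∀ n → + n / 1 ≡ mkℚ (+ n) 0 (coprime-1 n)
n/1≡mkℚ n = normalize-coprime (coprime-1 n)

-- In ℚᵘ the product is the unreduced fraction (1 · n) / (2 · 1), so ≤ is cross-multiplication.
½*-≤⇔ : ∀ n c → ½ ℚ.* (+ n / 1) ℚ.≤ + c / 1 ⇔ n ≤ c * 2
½*-≤⇔ n c rewrite n/1≡mkℚ n | n/1≡mkℚ c = mk⇔
  (λ h → ℤ.drop‿+≤+ (subst₂ ℤ._≤_ 1*n*1 (sym (ℤ.pos-* c 2))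
                       (drop-*≤* (≤-respˡ-≃ homo (toℚᵘ-mono-≤ h)))))
  (λ h → toℚᵘ-cancel-≤ (≤-respˡ-≃ (≃-sym homo)
                         (*≤* (subst₂ ℤ._≤_ (sym 1*n*1) (ℤ.pos-* c 2) (+≤+ h)))))
  where
  homo : toℚᵘ (½ ℚ.* mkℚ (+ n) 0 (coprime-1 n)) ≃ toℚᵘ ½ ℚᵘ.* toℚᵘ (mkℚ (+ n) 0 (coprime-1 n))
  homo = toℚᵘ-homo-* ½ (mkℚ (+ n) 0 (coprime-1 n))
  1*n*1 : (+ 1 ℤ.* + n) ℤ.* + 1 ≡ + n
  1*n*1 = trans (ℤ.*-identityʳ _) (ℤ.*-identityˡ (+ n))

T-∨-elim : ∀ a {b} → T (a ∨ b) → T a ⊎ T b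
T-∨-elim a = Equivalence.to (T-∨ {a})

T-∨-intro : ∀ a {b} → T a ⊎ T b → T (a ∨ b)
T-∨-intro a = Equivalence.from (T-∨ {a})

𝟙 : Bool → ℕ
𝟙 true = 1
𝟙 false = 0

count : (ℕ → Bool) → ℕ → ℕ
count s zero = 0
count s (suc n) = 𝟙 (s 0) + count (s ∘ suc) n

count-cong : ∀ {s t} n → (∀ j → j < n → s j ≡ t j) → count s n ≡ count t n
count-cong zero s≗t = refl
count-cong (suc n) s≗t = cong₂ _+_ (cong 𝟙 (s≗t 0 z<s)) (count-cong n (λ j → s≗t (suc j) ∘ s<s))

count-∨ : ∀ s t n → count (λ j → s j ∨ t j) n ≤ count s n + count t n
count-∨ s t zero = z≤n
count-∨ s t (suc n) = begin
  𝟙 (s 0 ∨ t 0) + count (λ j → s (suc j) ∨ t (suc j)) n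
    ≤⟨ +-mono-≤ (𝟙-∨ (s 0) (t 0)) (count-∨ (s ∘ suc) (t ∘ suc) n) ⟩
  (𝟙 (s 0) + 𝟙 (t 0)) + (count (s ∘ suc) n + count (t ∘ suc) n)
    ≡⟨ interchange (𝟙 (s 0)) (𝟙 (t 0)) _ _ ⟩
  count s (suc n) + count t (suc n) ∎
  where
  open ≤-Reasoning
  𝟙-∨ : ∀ a b → 𝟙 (a ∨ b) ≤ 𝟙 a + 𝟙 b
  𝟙-∨ true  b = s≤s z≤n
  𝟙-∨ false b = ≤-refl

count-last : ∀ s n → count s (suc n) ≡ count s n + 𝟙 (s n)
count-last s zero = +-comm (𝟙 (s 0)) 0
count-last s (suc n) =
  trans (cong (_+_ (𝟙 (s 0))) (count-last (s ∘ suc) n)) (sym (+-assoc (𝟙 (s 0)) _ _))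

prev : (ℕ → Bool) → ℕ → Bool
prev s zero = false
prev s (suc j) = s j

count-prev : ∀ s n → count (prev s) n ≤ count s n
count-prev s zero = z≤n
count-prev s (suc n) = subst (count s n ≤_) (sym (count-last s n)) (m≤m+n _ _)

count-next : ∀ s n → s n ≡ false → count (s ∘ suc) n ≤ count s n
count-next s n sn≡false = begin
  count (s ∘ suc) n              ≤⟨ m≤n+m _ (𝟙 (s 0)) ⟩
  count s (suc n)                ≡⟨ count-last s n ⟩
  count s n + 𝟙 (s n)            ≡⟨ cong (λ b → count s n + 𝟙 b) sn≡false ⟩
  count s n + 0                  ≡⟨ +-identityʳ _ ⟩
  count s n                      ∎
  where open ≤-Reasoning

pathNbhd : (ℕ → Bool) → ℕ → Bool
pathNbhd s j = prev s j ∨ s j ∨ s (suc j)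

count-pathNbhd : ∀ s n → s n ≡ false → count (pathNbhd s) n ≤ count s n * 3
count-pathNbhd s n sn≡false = begin
  count (pathNbhd s) n
    ≤⟨ count-∨ (prev s) _ n ⟩
  count (prev s) n + count (λ j → s j ∨ s (suc j)) n
    ≤⟨ +-monoʳ-≤ (count (prev s) n) (count-∨ s (s ∘ suc) n) ⟩
  count (prev s) n + (c + count (s ∘ suc) n)
    ≤⟨ +-mono-≤ (count-prev s n) (+-monoʳ-≤ c (count-next s n sn≡false)) ⟩
  c + (c + c)
    ≡⟨ cong (λ x → c + (c + x)) (+-identityʳ c) ⟨
  3 * c
    ≡⟨ *-comm 3 c ⟩
  c * 3 ∎
  where
  open ≤-Reasoning
  c : ℕ
  c = count s n

Near : ℕ → ℕ → Set
Near i j = i ≡ j ⊎ suc i ≡ j ⊎ suc j ≡ i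

T-pathNbhd : ∀ s j → T (pathNbhd s j) ⇔ (∃[ i ] T (s i) × Near i j)
T-pathNbhd s j = mk⇔ (to j ∘ T-∨-elim (prev s j)) from
  where
  to : ∀ j → T (prev s j) ⊎ T (s j ∨ s (suc j)) → ∃[ i ] T (s i) × Near i j
  to (suc i) (inj₁ si) = i , si , inj₂ (inj₁ refl)
  to j       (inj₂ h) with T-∨-elim (s j) h
  ... | inj₁ sj  = j , sj , inj₁ refl
  ... | inj₂ s1+j = suc j , s1+j , inj₂ (inj₂ refl)
  from : ∃[ i ] T (s i) × Near i j → T (pathNbhd s j)
  from (i , si , inj₁ refl)        = T-∨-intro (prev s i) (inj₂ (T-∨-intro (s i) (inj₁ si)))
  from (i , si , inj₂ (inj₁ refl)) = T-∨-intro (s i) (inj₁ si)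
  from (i , si , inj₂ (inj₂ refl)) = T-∨-intro (prev s j) (inj₂ (T-∨-intro (s j) (inj₂ si)))

at : ∀ {n} → Vec Bool n → ℕ → Bool
at []      j       = false
at (b ∷ v) zero    = b
at (b ∷ v) (suc j) = at v j

∣∣≡count-at : ∀ {n} (S : Subset n) → ∣ S ∣ ≡ count (at S) n
∣∣≡count-at []          = refl
∣∣≡count-at (true ∷ S)  = cong suc (∣∣≡count-at S)
∣∣≡count-at (false ∷ S) = ∣∣≡count-at S

at-length : ∀ {n} (v : Vec Bool n) → at v n ≡ false
at-length []      = refl
at-length (b ∷ v) = at-length v

at-toℕ : ∀ {n} (v : Vec Bool n) i → at v (toℕ i) ≡ lookup v i
at-toℕ (b ∷ v) fzero    = refl
at-toℕ (b ∷ v) (fsuc i) = at-toℕ v i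

at-true : ∀ {n} (v : Vec Bool n) j → T (at v j) → ∃[ i ] toℕ i ≡ j × T (lookup v i)
at-true (b ∷ v) zero    b-true = fzero , refl , b-true
at-true (b ∷ v) (suc j) vj     = let i , i≡j , vi = at-true v j vj in fsuc i , cong suc i≡j , vi

at-tabulate : ∀ {n} (f : Fin n → Bool) (g : ℕ → Bool) → (∀ i → f i ≡ g (toℕ i)) →
              ∀ j → j < n → at (tabulate f) j ≡ g j
at-tabulate f g f≗g zero    (s≤s _)   = f≗g fzero
at-tabulate f g f≗g (suc j) (s≤s j<n) = at-tabulate (f ∘ fsuc) (g ∘ suc) (f≗g ∘ fsuc) j j<n

T-any : ∀ {A : Set} {n} (p : A → Bool) (xs : Fin n → A) →
        T (ffoldr (λ x b → p x ∨ b) false xs) ⇔ (∃[ i ] T (p (xs i)))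
T-any {n = zero}  p xs = mk⇔ (λ ()) (λ ())
T-any {n = suc n} p xs = mk⇔ to from
  where
  to : T (p (xs fzero) ∨ ffoldr (λ x b → p x ∨ b) false (xs ∘ fsuc)) → ∃[ i ] T (p (xs i))
  to h with T-∨-elim (p (xs fzero)) h
  ... | inj₁ p0 = fzero , p0
  ... | inj₂ ps = let i , pi = Equivalence.to (T-any p (xs ∘ fsuc)) ps in fsuc i , pi
  from : ∃[ i ] T (p (xs i)) → T (p (xs fzero) ∨ ffoldr (λ x b → p x ∨ b) false (xs ∘ fsuc))
  from (fzero , p0)  = T-∨-intro (p (xs fzero)) (inj₁ p0)
  from (fsuc i , pi) =
    T-∨-intro (p (xs fzero)) (inj₂ (Equivalence.from (T-any p (xs ∘ fsuc)) (i , pi)))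

T-inClosedNbhd : ∀ {n} (G : Graph n) S u →
                 T (inClosedNbhd G S u) ⇔ (∃[ v ] T (lookup S v) × (u ≡ v ⊎ T (adj G v u)))
T-inClosedNbhd G S u =
  mk⇔ (to ∘ Equivalence.to (T-any p (λ v → v))) (Equivalence.from (T-any p (λ v → v)) ∘ from)
  where
  p : Fin _ → Bool
  p v = lookup S v ∧ (⌊ u ≟ᶠ v ⌋ ∨ adj G v u)
  to : ∃[ v ] T (p v) → ∃[ v ] T (lookup S v) × (u ≡ v ⊎ T (adj G v u))
  to (v , pv) with Equivalence.to (T-∧ {lookup S v}) pv
  ... | Sv , close with T-∨-elim (⌊ u ≟ᶠ v ⌋) close
  ...   | inj₁ u≡v   = v , Sv , inj₁ (toWitness u≡v)
  ...   | inj₂ v~u   = v , Sv , inj₂ v~u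
  from : ∃[ v ] T (lookup S v) × (u ≡ v ⊎ T (adj G v u)) → ∃[ v ] T (p v)
  from (v , Sv , close) =
    v , Equivalence.from (T-∧ {lookup S v}) (Sv , T-∨-intro ⌊ u ≟ᶠ v ⌋ (map₁ fromWitness close))

T-pathAdj : ∀ {n} (v u : Fin n) → T (pathAdj v u) ⇔ (suc (toℕ v) ≡ toℕ u ⊎ suc (toℕ u) ≡ toℕ v)
T-pathAdj v u = mk⇔
  (map toWitness toWitness ∘ T-∨-elim ⌊ suc (toℕ v) ≟ toℕ u ⌋)
  (T-∨-intro ⌊ suc (toℕ v) ≟ toℕ u ⌋ ∘ map fromWitness fromWitness)

T-inClosedNbhd-Path : ∀ {n} (S : Subset n) u →
                      T (inClosedNbhd (Path n) S u) ⇔ (∃[ v ] T (lookup S v) × Near (toℕ v) (toℕ u))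
T-inClosedNbhd-Path S u = mk⇔
  (λ h → let v , Sv , close = Equivalence.to (T-inClosedNbhd (Path _) S u) h in v , Sv , to v close)
  (λ (v , Sv , near) → Equivalence.from (T-inClosedNbhd (Path _) S u) (v , Sv , from v near))
  where
  to : ∀ v → u ≡ v ⊎ T (pathAdj v u) → Near (toℕ v) (toℕ u)
  to v (inj₁ u≡v) = inj₁ (cong toℕ (sym u≡v))
  to v (inj₂ v~u) = inj₂ (Equivalence.to (T-pathAdj v u) v~u)
  from : ∀ v → Near (toℕ v) (toℕ u) → u ≡ v ⊎ T (pathAdj v u)
  from v (inj₁ v≡u)  = inj₁ (sym (toℕ-injective v≡u))
  from v (inj₂ v~u) = inj₂ (Equivalence.from (T-pathAdj v u) v~u)

inClosedNbhd-Path : ∀ {n} (S : Subset n) u → inClosedNbhd (Path n) S u ≡ pathNbhd (at S) (toℕ u)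
inClosedNbhd-Path S u = ⇔→≡ {z = true} (T-≡ ⇔-∘ (T⇔T ⇔-∘ ⇔-sym T-≡))
  where
  atBridge : (∃[ v ] T (lookup S v) × Near (toℕ v) (toℕ u)) ⇔ (∃[ i ] T (at S i) × Near i (toℕ u))
  atBridge = mk⇔
    (λ (v , Sv , near) → toℕ v , subst T (sym (at-toℕ S v)) Sv , near)
    (λ (i , Si , near) → let v , v≡i , Sv = at-true S i Si
                          in v , Sv , subst (λ k → Near k (toℕ u)) (sym v≡i) near)
  T⇔T : T (inClosedNbhd (Path _) S u) ⇔ T (pathNbhd (at S) (toℕ u))
  T⇔T = ⇔-sym (T-pathNbhd (at S) (toℕ u)) ⇔-∘ (atBridge ⇔-∘ T-inClosedNbhd-Path S u)

∣closedNbhd-Path∣ : ∀ {n} (S : Subset n) → ∣ closedNbhd (Path n) S ∣ ≡ count (pathNbhd (at S)) n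
∣closedNbhd-Path∣ {n} S = trans (∣∣≡count-at (closedNbhd (Path n) S))
  (count-cong n (at-tabulate (inClosedNbhd (Path n) S) (pathNbhd (at S)) (inClosedNbhd-Path S)))

∣closedNbhd-Path∣≤ : ∀ {n} (S : Subset n) → ∣ closedNbhd (Path n) S ∣ ≤ ∣ S ∣ * 3
∣closedNbhd-Path∣≤ {n} S = begin
  ∣ closedNbhd (Path n) S ∣     ≡⟨ ∣closedNbhd-Path∣ S ⟩
  count (pathNbhd (at S)) n   ≤⟨ count-pathNbhd (at S) n (at-length S) ⟩
  count (at S) n * 3          ≡⟨ cong (_* 3) (∣∣≡count-at S) ⟨
  ∣ S ∣ * 3                   ∎
  where open ≤-Reasoning

-- The vertices min (6i + 1, n − 1); vertex 6i + 1 dominates 6i, 6i + 1 and 6i + 2,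
-- half of its block of six.
pathHalfDominator : ∀ n → Subset n
pathHalfDominator 0 = []
pathHalfDominator 1 = inside ∷ []
pathHalfDominator 2 = outside ∷ inside ∷ []
pathHalfDominator 3 = outside ∷ inside ∷ outside ∷ []
pathHalfDominator 4 = outside ∷ inside ∷ outside ∷ outside ∷ []
pathHalfDominator 5 = outside ∷ inside ∷ outside ∷ outside ∷ outside ∷ []
pathHalfDominator (suc (suc (suc (suc (suc (suc n)))))) =
  outside ∷ inside ∷ outside ∷ outside ∷ outside ∷ outside ∷ pathHalfDominator n

∣pathHalfDominator∣ : ∀ n → IsCeilDiv n 6 ∣ pathHalfDominator n ∣
∣pathHalfDominator∣ 0 = ceilDiv z≤n z<s
∣pathHalfDominator∣ 1 = ceilDiv (≤ᵇ⇒≤ 1 6 _) (≤ᵇ⇒≤ 7 7 _)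
∣pathHalfDominator∣ 2 = ceilDiv (≤ᵇ⇒≤ 2 6 _) (≤ᵇ⇒≤ 7 8 _)
∣pathHalfDominator∣ 3 = ceilDiv (≤ᵇ⇒≤ 3 6 _) (≤ᵇ⇒≤ 7 9 _)
∣pathHalfDominator∣ 4 = ceilDiv (≤ᵇ⇒≤ 4 6 _) (≤ᵇ⇒≤ 7 10 _)
∣pathHalfDominator∣ 5 = ceilDiv (≤ᵇ⇒≤ 5 6 _) (≤ᵇ⇒≤ 7 11 _)
∣pathHalfDominator∣ (suc (suc (suc (suc (suc (suc n)))))) =
  let ceilDiv n≤ <n+6 = ∣pathHalfDominator∣ n in ceilDiv (+-monoʳ-≤ 6 n≤) (+-monoʳ-< 6 <n+6)

at-outside∷ : ∀ {n} (S : Subset n) j → at (outside ∷ S) j ≡ prev (at S) j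
at-outside∷ S zero    = refl
at-outside∷ S (suc j) = refl

pathHalfDominator-dominates : ∀ n → n ≤ count (pathNbhd (at (pathHalfDominator n))) n * 2
pathHalfDominator-dominates 0 = z≤n
pathHalfDominator-dominates 1 = ≤ᵇ⇒≤ 1 2 _
pathHalfDominator-dominates 2 = ≤ᵇ⇒≤ 2 4 _
pathHalfDominator-dominates 3 = ≤ᵇ⇒≤ 3 6 _
pathHalfDominator-dominates 4 = ≤ᵇ⇒≤ 4 6 _
pathHalfDominator-dominates 5 = ≤ᵇ⇒≤ 5 6 _
-- On the first block of six the count computes to 1 + 1 + 1 + 0 + 0 + 𝟙 (at D 0) + count tail n.
pathHalfDominator-dominates (suc (suc (suc (suc (suc (suc n)))))) = +-monoʳ-≤ 6 (begin
  n                                                  ≤⟨ pathHalfDominator-dominates n ⟩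
  count (pathNbhd (at D)) n * 2                      ≡⟨ cong (_* 2) (count-cong n tail≡) ⟨
  count tail n * 2                                   ≤⟨ *-monoˡ-≤ 2 (m≤n+m _ (𝟙 (at D 0))) ⟩
  (𝟙 (at D 0) + count tail n) * 2                    ∎)
  where
  open ≤-Reasoning
  D : Subset n
  D = pathHalfDominator n
  tail : ℕ → Bool
  tail j = at (outside ∷ D) j ∨ at D j ∨ at D (suc j)
  tail≡ : ∀ j → j < n → tail j ≡ pathNbhd (at D) j
  tail≡ j _ = cong (_∨ at D j ∨ at D (suc j)) (at-outside∷ D j)

proposition2p7 : ∀ (n : ℕ) → n ≥ 1 →
    Σ ℕ (λ k → (+ k ≡ ceiling ((+ n) / 6)) × IsPDominationNumber ((+ 1) / 2) (Path n) k)
proposition2p7 n _ =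
  ∣ D ∣ , sym (ceiling-/ n 6 (∣pathHalfDominator∣ n)) , (D , D-dominating , refl) , minimal
  where
  D : Subset n
  D = pathHalfDominator n
  D-dominating : IsPDominating ½ (Path n) D
  D-dominating = Equivalence.from (½*-≤⇔ n ∣ closedNbhd (Path n) D ∣)
    (subst (λ c → n ≤ c * 2) (sym (∣closedNbhd-Path∣ D)) (pathHalfDominator-dominates n))
  minimal : ∀ S → IsPDominating ½ (Path n) S → ∣ D ∣ ≤ ∣ S ∣
  minimal S S-dominating = IsCeilDiv-least (∣pathHalfDominator∣ n) (begin
    n                              ≤⟨ Equivalence.to (½*-≤⇔ n ∣ closedNbhd (Path n) S ∣) S-dominating ⟩
    ∣ closedNbhd (Path n) S ∣ * 2  ≤⟨ *-monoˡ-≤ 2 (∣closedNbhd-Path∣≤ S) ⟩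
    ∣ S ∣ * 3 * 2                  ≡⟨ *-assoc ∣ S ∣ 3 2 ⟩
    ∣ S ∣ * 6                      ∎)
    where open ≤-Reasoning
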